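{- Let $a\ge 2$ be even and let $c,e$ be odd integers with $0<c<e\le\frac a2$. Then $U=\{(a,-a),(c,-c),(e,-e)\}$ is unavoidable in $\mathcal{B}$.
   Context: The bicyclic inverse semigroup is $\mathcal{B}=\{(a,b)\in\mathbb{Z}\times\mathbb{Z}\mid a\ge 0,\ a+b\ge 0\}$ with multiplication $(a,b)(c,d)=(\max\{c+d,a\}-d,\ b+d)$. A subset $U\subseteq\mathcal{B}$ is avoidable if $\mathcal{B}$ can be partitioned into two sets $A$ and $B$ such that no element of $U$ is a product $st$ of two distinct elements $s\ne t$ both in $A$ or both in $B$; otherwise $U$ is unavoidable. -}

module Defs where

open import Data.Integer using (ℤ; +_; _+_; _-_; -_; _≤_; _⊔_)
open import Data.Product using (_×_; _,_; Σ; ∃)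
open import Data.Bool using (Bool)
open import Data.Nat using (ℕ)
open import Relation.Binary.PropositionalEquality using (_≡_; _≢_)
open import Relation.Nullary using (¬_)

Pair : Set
Pair = ℤ × ℤ

InB : Pair → Set
InB (a , b) = (+ 0 ≤ a) × (+ 0 ≤ a + b)

𝓑 : Set
𝓑 = Σ Pair InB

_·_ : Pair → Pair → Pair
(a , b) · (c , d) = ((c + d) ⊔ a) - d , b + d

-- A partition of B into two sets A, B is a 2-colouring χ : 𝓑 → Bool
-- (A = χ⁻¹(true), B = χ⁻¹(false)).
Avoidable : (Pair → Set) → Set
Avoidable U = ∃ λ (χ : 𝓑 → Bool) →
  ∀ (s t : 𝓑) → Data.Product.proj₁ s ≢ Data.Product.proj₁ t → χ s ≡ χ t →
    ¬ U (Data.Product.proj₁ s · Data.Product.proj₁ t)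

Unavoidable : (Pair → Set) → Set
Unavoidable U = ¬ Avoidable U

U₃ : ℤ → ℤ → ℤ → Pair → Set
U₃ a c e p = (p ≡ (a , - a)) Data.Sum.⊎ ((p ≡ (c , - c)) Data.Sum.⊎ (p ≡ (e , - e)))
  where import Data.Sum

module Submission where

-- Write ι x = (x , -x); these are the idempotents of the
-- bicyclic semigroup, and they multiply by adding first coordinates:
-- ι x · ι y = ι (x + y) for x ≥ 0.  Moreover right multiplication by
-- (0 , w) shifts an idempotent down: ι (w + x) · (0 , w) = ι x.
-- Since a is even, c and e are odd, and c + e ≤ 2e ≤ a, we can write
-- a = (w + c) + (w + e) with w ≥ 0.  Then the three distinct elements
--   s₁ = ι (w + c),  s₂ = ι (w + e),  s₃ = (0 , w)
-- satisfy s₁·s₂ = ι a, s₁·s₃ = ι c, s₂·s₃ = ι e: every pair of them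
-- multiplies into U.  In any 2-colouring two of the three share a colour
-- (pigeonhole), so U is unavoidable.

open import Defs
open import Data.Integer using (ℤ; +_; _+_; _*_; _<_; _≤_; _-_; -_; _⊔_)
open import Data.Integer.Properties
open import Data.Integer.Tactic.RingSolver using (solve-∀)
open import Data.Product using (∃; _×_; _,_; proj₁)
open import Data.Sum using (_⊎_; inj₁; inj₂)
open import Data.Bool using (Bool; true; false)
open import Relation.Binary.PropositionalEquality

ι : ℤ → Pair
ι x = x , - x

ιᴮ : (x : ℤ) → + 0 ≤ x → 𝓑
ιᴮ x 0≤x = ι x , 0≤x , ≤-reflexive (sym (+-inverseʳ x))

shiftᴮ : (w : ℤ) → + 0 ≤ w → 𝓑
shiftᴮ w 0≤w = (+ 0 , w) , ≤-refl , subst (+ 0 ≤_) (sym (+-identityˡ w)) 0≤w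

ι-·-ι : ∀ x y → + 0 ≤ x → ι x · ι y ≡ ι (x + y)
ι-·-ι x y 0≤x = cong₂ _,_ first (sym (neg-distrib-+ x y))
  where
  first : ((y + - y) ⊔ x) - - y ≡ x + y
  first = begin
    ((y + - y) ⊔ x) - - y ≡⟨ cong (λ z → (z ⊔ x) - - y) (+-inverseʳ y) ⟩
    (+ 0 ⊔ x) - - y       ≡⟨ cong (_- - y) (i≤j⇒i⊔j≡j 0≤x) ⟩
    x + - - y             ≡⟨ cong (λ z → x + z) (neg-involutive y) ⟩
    x + y                 ∎
    where open ≡-Reasoning

ι-·-shift : ∀ w x → + 0 ≤ x → ι (w + x) · (+ 0 , w) ≡ ι x
ι-·-shift w x 0≤x = cong₂ _,_ first second
  where
  w≤w+x : w ≤ w + x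
  w≤w+x = subst (_≤ w + x) (+-identityʳ w) (+-monoʳ-≤ w 0≤x)
  first : ((+ 0 + w) ⊔ (w + x)) - w ≡ x
  first = begin
    ((+ 0 + w) ⊔ (w + x)) - w ≡⟨ cong (λ z → (z ⊔ (w + x)) - w) (+-identityˡ w) ⟩
    (w ⊔ (w + x)) - w         ≡⟨ cong (_- w) (i≤j⇒i⊔j≡j w≤w+x) ⟩
    (w + x) - w               ≡⟨ cancelShift w x ⟩
    x                         ∎
    where
    open ≡-Reasoning
    cancelShift : ∀ w x → (w + x) - w ≡ x
    cancelShift = solve-∀
  second : - (w + x) + w ≡ - x
  second = negShift w x
    where
    negShift : ∀ w x → - (w + x) + w ≡ - x
    negShift = solve-∀

twoOfThreeAgree : (x y z : Bool) → (x ≡ y) ⊎ ((x ≡ z) ⊎ (y ≡ z))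
twoOfThreeAgree true  true  _     = inj₁ refl
twoOfThreeAgree false false _     = inj₁ refl
twoOfThreeAgree true  false true  = inj₂ (inj₁ refl)
twoOfThreeAgree true  false false = inj₂ (inj₂ refl)
twoOfThreeAgree false true  true  = inj₂ (inj₂ refl)
twoOfThreeAgree false true  false = inj₂ (inj₁ refl)

triangle⇒unavoidable : (U : Pair → Set) (s₁ s₂ s₃ : 𝓑) →
  proj₁ s₁ ≢ proj₁ s₂ → proj₁ s₁ ≢ proj₁ s₃ → proj₁ s₂ ≢ proj₁ s₃ →
  U (proj₁ s₁ · proj₁ s₂) → U (proj₁ s₁ · proj₁ s₃) → U (proj₁ s₂ · proj₁ s₃) →
  Unavoidable U
triangle⇒unavoidable U s₁ s₂ s₃ s₁≢s₂ s₁≢s₃ s₂≢s₃ u₁₂ u₁₃ u₂₃ (χ , avoids)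
  with twoOfThreeAgree (χ s₁) (χ s₂) (χ s₃)
... | inj₁ same        = avoids s₁ s₂ s₁≢s₂ same u₁₂
... | inj₂ (inj₁ same) = avoids s₁ s₃ s₁≢s₃ same u₁₃
... | inj₂ (inj₂ same) = avoids s₂ s₃ s₂≢s₃ same u₂₃

-- The triangle ι (w + c), ι (w + e), (0 , w) for the set
-- {ι ((w + c) + (w + e)), ι c, ι e}: this is the theorem for
-- a = (w + c) + (w + e), with no parity assumptions needed.
triangleUnavoidable : ∀ w c e → + 0 ≤ w → + 0 < c → c < e →
  Unavoidable (U₃ ((w + c) + (w + e)) c e)
triangleUnavoidable w c e 0≤w 0<c c<e =
  triangle⇒unavoidable (U₃ ((w + c) + (w + e)) c e)
    (ιᴮ (w + c) (<⇒≤ 0<w+c)) (ιᴮ (w + e) (<⇒≤ 0<w+e)) (shiftᴮ w 0≤w)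
    (λ eq → <⇒≢ (+-monoʳ-< w c<e) (cong proj₁ eq))
    (λ eq → <⇒≢ 0<w+c (sym (cong proj₁ eq)))
    (λ eq → <⇒≢ 0<w+e (sym (cong proj₁ eq)))
    (inj₁ (ι-·-ι (w + c) (w + e) (<⇒≤ 0<w+c)))
    (inj₂ (inj₁ (ι-·-shift w c (<⇒≤ 0<c))))
    (inj₂ (inj₂ (ι-·-shift w e (<⇒≤ 0<e))))
  where
  0<e : + 0 < e
  0<e = <-trans 0<c c<e
  0<w+c : + 0 < w + c
  0<w+c = +-mono-≤-< 0≤w 0<c
  0<w+e : + 0 < w + e
  0<w+e = +-mono-≤-< 0≤w 0<e

-- Arithmetic: an even a and odd c, e with c + e ≤ a split as
-- a = (w + c) + (w + e) for some w ≥ 0, namely w = (a - c - e) / 2.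
evenSplit : ∀ ka kc ke → (+ 2 * kc + + 1) + (+ 2 * ke + + 1) ≤ + 2 * ka →
  ∃ λ w → + 0 ≤ w × + 2 * ka ≡ (w + (+ 2 * kc + + 1)) + (w + (+ 2 * ke + + 1))
evenSplit ka kc ke c+e≤a = w , 0≤w , decomposition ka kc ke
  where
  w : ℤ
  w = ka - (kc + ke + + 1)
  twiceW : ∀ ka kc ke →
    + 2 * (ka - (kc + ke + + 1)) ≡ + 2 * ka - ((+ 2 * kc + + 1) + (+ 2 * ke + + 1))
  twiceW = solve-∀
  0≤w : + 0 ≤ w
  0≤w = *-cancelˡ-≤-pos (+ 0) w (+ 2)
          (subst (+ 0 ≤_) (sym (twiceW ka kc ke)) (i≤j⇒0≤j-i c+e≤a))
  decomposition : ∀ ka kc ke → + 2 * ka ≡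
    ((ka - (kc + ke + + 1)) + (+ 2 * kc + + 1)) + ((ka - (kc + ke + + 1)) + (+ 2 * ke + + 1))
  decomposition = solve-∀

sumBelow : ∀ a c e → c < e → + 2 * e ≤ a → c + e ≤ a
sumBelow a c e c<e 2e≤a =
  ≤-trans (+-monoˡ-≤ e (<⇒≤ c<e)) (subst (_≤ a) (twice e) 2e≤a)
  where
  twice : ∀ e → + 2 * e ≡ e + e
  twice = solve-∀

mainTheorem6 : (a c e : ℤ) → + 2 ≤ a → (∃ λ k → a ≡ + 2 * k) →
    (∃ λ k → c ≡ + 2 * k + + 1) → (∃ λ k → e ≡ + 2 * k + + 1) →
    + 0 < c → c < e → + 2 * e ≤ a →
    Unavoidable (U₃ a c e)
mainTheorem6 a c e _ (ka , refl) (kc , refl) (ke , refl) 0<c c<e 2e≤a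
  with evenSplit ka kc ke (sumBelow a c e c<e 2e≤a)
... | w , 0≤w , a≡split =
  subst (λ x → Unavoidable (U₃ x c e)) (sym a≡split)
    (triangleUnavoidable w c e 0≤w 0<c c<e)
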